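{- Fix $n\ge 1$. (1) For each realizable sample $S=(P,N)$ (with $P,N\subseteq\mathbb{Z}^n$), there exist hyperrectangles that are maximal with respect to inclusion among the hyperrectangles consistent with $S$ (possibly more than one). (2) For each $p\in\mathbb{Z}^n$, the set $\mathcal{R}_p$ of hyperrectangles containing $p$ is well-quasi-ordered by inclusion.
   Context: An interval is $[l,r]$ with $l,r\in\mathbb{Z}\cup\{ -\infty,\infty\}$ and $l\le r$, denoting the set $\{x\in\mathbb{Z}\mid l\le x\le r\}$; inclusion of intervals is $[l,r]\subseteq[l',r']$ iff $l\ge l'$ and $r\le r'$. An $n$-dimensional hyperrectangle is a product $[l_1,r_1]\times\cdots\times[l_n,r_n]$ of intervals, viewed as a set of points in $\mathbb{Z}^n$; inclusion of hyperrectangles is componentwise inclusion of the intervals. A sample is a pair $S=(P,N)$ of sets of points of $\mathbb{Z}^n$ (positive and negative examples); a hyperrectangle $R$ is consistent with $(P,N)$ if $P\subseteq R$ and $R\cap N=\emptyset$; the sample is realizable if some hyperrectangle is consistent with it. A well-quasi-order on a set $X$ is a reflexive transitive relation $\preceq$ such that every infinite sequence $x_0,x_1,\ldots$ in $X$ has indices $i<j$ with $x_i\preceq x_j$. -}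

module Defs where

open import Data.Nat using (ℕ)
open import Data.Integer using (ℤ) renaming (_≤_ to _≤ℤ_)
open import Data.Fin using (Fin)
open import Data.Product using (Σ; _×_; ∃)
open import Relation.Nullary using (¬_; Dec)

data ℤ∞ : Set where
  -∞  : ℤ∞
  fin : ℤ → ℤ∞
  +∞  : ℤ∞

data _≤∞_ : ℤ∞ → ℤ∞ → Set where
  -∞≤   : ∀ {y} → -∞ ≤∞ y
  fin≤fin : ∀ {x y} → x ≤ℤ y → fin x ≤∞ fin y
  ≤+∞   : ∀ {x} → x ≤∞ +∞

record Interval : Set where
  constructor [_,_]⟨_⟩
  field
    lo   : ℤ∞
    hi   : ℤ∞
    lo≤hi : lo ≤∞ hi
open Interval public

_∈I_ : ℤ → Interval → Set
x ∈I I = (lo I ≤∞ fin x) × (fin x ≤∞ hi I)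

_⊆I_ : Interval → Interval → Set
I ⊆I J = (lo J ≤∞ lo I) × (hi I ≤∞ hi J)

Point : ℕ → Set
Point n = Fin n → ℤ

Hyperrectangle : ℕ → Set
Hyperrectangle n = Fin n → Interval

_∈R_ : ∀ {n} → Point n → Hyperrectangle n → Set
p ∈R R = ∀ i → p i ∈I R i

_⊆R_ : ∀ {n} → Hyperrectangle n → Hyperrectangle n → Set
R ⊆R R' = ∀ i → R i ⊆I R' i

record Sample (n : ℕ) : Set₁ where
  constructor ⟨_,_⟩
  field
    Pos : Point n → Set
    Neg : Point n → Set
open Sample public

Consistent : ∀ {n} → Hyperrectangle n → Sample n → Set
Consistent R S = (∀ p → Pos S p → p ∈R R) × (∀ p → Neg S p → ¬ (p ∈R R))

Realizable : ∀ {n} → Sample n → Set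
Realizable S = ∃ λ R → Consistent R S

MaximalConsistent : ∀ {n} → Hyperrectangle n → Sample n → Set
MaximalConsistent R S =
  Consistent R S × (∀ R' → Consistent R' S → R ⊆R R' → R' ⊆R R)

record IsWQO (X : Set) (_≼_ : X → X → Set) : Set where
  field
    refl  : ∀ x → x ≼ x
    trans : ∀ {x y z} → x ≼ y → y ≼ z → x ≼ z
    good  : (f : ℕ → X) → Σ ℕ λ i → Σ ℕ λ j → (i Data.Nat.< j) × (f i ≼ f j)

ℛ : ∀ {n} → Point n → Set
ℛ {n} p = Σ (Hyperrectangle n) λ R → p ∈R R

_⊆ℛ_ : ∀ {n} {p : Point n} → ℛ p → ℛ p → Set
A ⊆ℛ B = Data.Product.proj₁ A ⊆R Data.Product.proj₁ B

ExcludedMiddle : Set₁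
ExcludedMiddle = (A : Set) → Dec A

module Submission where

open import Defs
open import Data.Nat using (ℕ; _≤_)
open import Data.Product using (_×_; ∃)

open import Data.Nat using (zero; suc; _<_)
open import Data.Nat.Induction using (<-rec)
import Data.Nat.Properties as ℕ
open import Data.Integer using (ℤ; +_; +≤+; _-_; ∣_∣) renaming (_+_ to _+ℤ_; -_ to -ℤ_; _≤_ to _≤ℤ_)
import Data.Integer.Properties as ℤ
open import Data.Integer.Tactic.RingSolver using (solve-∀)
open import Data.Fin using (Fin) renaming (zero to fzero; suc to fsuc; _≟_ to _≟F_)
open import Data.Product using (Σ; _,_; proj₁; proj₂)
open import Data.Sum using (inj₁; inj₂)
open import Data.Empty using (⊥-elim)
open import Data.Unit using (⊤; tt)
open import Data.List using (List; []; _∷_; allFin)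
open import Data.List.Relation.Unary.All as All using (All; []; _∷_)
open import Data.List.Membership.Propositional.Properties using (∈-allFin)
open import Function using (_∘_)
open import Relation.Nullary using (¬_; yes; no)
open import Relation.Nullary.Decidable using (decidable-stable)
open import Relation.Binary.PropositionalEquality
  using (_≡_; _≢_; refl; sym; trans; cong; subst)

-- Both parts rest on one classical fact: a nonempty set of extended integers
-- bounded below (above) by an integer has a least (greatest) element; it comes
-- from the least-number principle on ℕ, translating ℤ above a bound onto ℕ.
--
-- (1) From a consistent R, treat each coordinate c in turn: push the lower end
-- of R c down to the least value admitting no negative example, then the
-- upper end up to the greatest.  The result is tight at c (consistent
-- enlargements agree with it at c); tightness survives later enlargements, so
-- after all coordinates the rectangle is maximal.
--
-- (2) Lower ends of rectangles containing p are bounded above by p, so every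
-- sequence of them attains a maximum and is good for ≥; dually for upper
-- ends.  A Ramsey-type argument turns "transitive and good" into "every
-- sequence has an ascending subsequence", which is closed under finite
-- intersections of relations; inclusion is such an intersection.

≤∞-refl : ∀ {x} → x ≤∞ x
≤∞-refl { -∞}    = -∞≤
≤∞-refl {fin x} = fin≤fin ℤ.≤-refl
≤∞-refl {+∞}    = ≤+∞

≤∞-trans : ∀ {x y z} → x ≤∞ y → y ≤∞ z → x ≤∞ z
≤∞-trans -∞≤         _           = -∞≤
≤∞-trans (fin≤fin p) (fin≤fin q) = fin≤fin (ℤ.≤-trans p q)
≤∞-trans (fin≤fin p) ≤+∞         = ≤+∞
≤∞-trans ≤+∞         ≤+∞         = ≤+∞

fin≤fin⁻¹ : ∀ {x y} → fin x ≤∞ fin y → x ≤ℤ y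
fin≤fin⁻¹ (fin≤fin p) = p

fin≰-∞ : ∀ {x} → ¬ (fin x ≤∞ -∞)
fin≰-∞ ()

_≥∞_ : ℤ∞ → ℤ∞ → Set
x ≥∞ y = y ≤∞ x

-- Negation is an order-reversing involution of ℤ∞; it turns statements
-- about least elements into statements about greatest ones.
neg∞ : ℤ∞ → ℤ∞
neg∞ -∞      = +∞
neg∞ (fin x) = fin (-ℤ x)
neg∞ +∞      = -∞

neg∞-involutive : ∀ x → neg∞ (neg∞ x) ≡ x
neg∞-involutive -∞      = refl
neg∞-involutive (fin x) = cong fin (ℤ.neg-involutive x)
neg∞-involutive +∞      = refl

neg∞-anti : ∀ {x y} → x ≤∞ y → neg∞ y ≤∞ neg∞ x
neg∞-anti -∞≤         = ≤+∞
neg∞-anti (fin≤fin p) = fin≤fin (ℤ.neg-mono-≤ p)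
neg∞-anti ≤+∞         = -∞≤

neg∞-swapˡ : ∀ {x y} → neg∞ x ≤∞ y → neg∞ y ≤∞ x
neg∞-swapˡ {x} {y} p = subst (neg∞ y ≤∞_) (neg∞-involutive x) (neg∞-anti p)

neg∞-swapʳ : ∀ {x y} → x ≤∞ neg∞ y → y ≤∞ neg∞ x
neg∞-swapʳ {x} {y} p = subst (_≤∞ neg∞ x) (neg∞-involutive y) (neg∞-anti p)

⊆I-trans : ∀ {I J K} → I ⊆I J → J ⊆I K → I ⊆I K
⊆I-trans (l₁ , h₁) (l₂ , h₂) = ≤∞-trans l₂ l₁ , ≤∞-trans h₁ h₂

⊆R-refl : ∀ {n} (R : Hyperrectangle n) → R ⊆R R
⊆R-refl R i = ≤∞-refl , ≤∞-refl

⊆R-trans : ∀ {n} (R R' R'' : Hyperrectangle n) → R ⊆R R' → R' ⊆R R'' → R ⊆R R''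
⊆R-trans R R' R'' s t i = ⊆I-trans {R i} {R' i} {R'' i} (s i) (t i)

∈I-⊆ : ∀ {x I J} → x ∈I I → I ⊆I J → x ∈I J
∈I-⊆ (l , h) (l' , h') = ≤∞-trans l' l , ≤∞-trans h h'

∈R-⊆ : ∀ {n} {q : Point n} (R R' : Hyperrectangle n) → q ∈R R → R ⊆R R' → q ∈R R'
∈R-⊆ {q = q} R R' m s i = ∈I-⊆ {q i} {R i} {R' i} (m i) (s i)

infixl 30 _[_≔_]

_[_≔_] : ∀ {n} → Hyperrectangle n → Fin n → Interval → Hyperrectangle n
(R [ c ≔ J ]) i with i ≟F c
... | yes _ = J
... | no  _ = R i

≔-at : ∀ {n} (R : Hyperrectangle n) c J → (R [ c ≔ J ]) c ≡ J
≔-at R c J with c ≟F c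
... | yes _  = refl
... | no c≢c = ⊥-elim (c≢c refl)

InExcept : ∀ {n} → Fin n → Point n → Hyperrectangle n → Set
InExcept c q R = ∀ i → i ≢ c → q i ∈I R i

⊆-≔ : ∀ {n} {R : Hyperrectangle n} {c J} → R c ⊆I J → R ⊆R R [ c ≔ J ]
⊆-≔ {c = c} s i with i ≟F c
... | yes refl = s
... | no  _    = ≤∞-refl , ≤∞-refl

∈-≔ : ∀ {n} {q : Point n} {R c J} → q ∈R R [ c ≔ J ] → q c ∈I J × InExcept c q R
∈-≔ {q = q} {R} {c} {J} m = subst (q c ∈I_) (≔-at R c J) (m c) , off
  where
  off : InExcept c q R
  off i i≢c with i ≟F c | m i
  ... | yes i≡c | _  = ⊥-elim (i≢c i≡c)
  ... | no  _   | mi = mi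

inExcept-∈ : ∀ {n} {q : Point n} {c} (R R' : Hyperrectangle n) →
             InExcept c q R → q c ∈I R' c → R ⊆R R' → q ∈R R'
inExcept-∈ {q = q} {c} R R' off qc s i with i ≟F c
... | yes refl = qc
... | no  i≢c  = ∈I-⊆ {q i} {R i} {R' i} (off i i≢c) (s i)

b+[z-b]≡z : ∀ b z → b +ℤ (z - b) ≡ z
b+[z-b]≡z = solve-∀

offset : ∀ {b z} → b ≤ℤ z → b +ℤ + ∣ z - b ∣ ≡ z
offset {b} {z} b≤z =
  trans (cong (b +ℤ_) (ℤ.0≤i⇒+∣i∣≡i (ℤ.i≤j⇒0≤j-i b≤z))) (b+[z-b]≡z b z)

IsLeast : {A : Set} → (A → A → Set) → (A → Set) → A → Set
IsLeast _≼_ P v = P v × (∀ w → P w → v ≼ w)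

Chain : {Y : Set} → (Y → Y → Set) → (ℕ → Y) → Set
Chain _≼_ h = ∀ {i j} → i < j → h i ≼ h j

Good : {X : Set} → (X → X → Set) → (ℕ → X) → Set
Good _≼_ f = Σ ℕ λ i → Σ ℕ λ j → i < j × f i ≼ f j

Ascending : {X : Set} → (X → X → Set) → Set
Ascending {X} _≼_ = (f : ℕ → X) → Σ (ℕ → ℕ) λ g → Chain _<_ g × Chain _≼_ (f ∘ g)

steps⇒chain : {Y : Set} {_≼_ : Y → Y → Set} {h : ℕ → Y} →
              (∀ {a b c} → a ≼ b → b ≼ c → a ≼ c) →
              (∀ k → h k ≼ h (suc k)) → Chain _≼_ h
steps⇒chain trans' step {j = zero}  ()
steps⇒chain {_≼_ = _≼_} {h} trans' step {i} {suc j} i<1+j with ℕ.m<1+n⇒m<n∨m≡n i<1+j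
... | inj₁ i<j  = trans' (steps⇒chain {_≼_ = _≼_} {h} trans' step i<j) (step j)
... | inj₂ refl = step i

iterate : (U : ℕ → Set) (T : ℕ → ℕ → Set) →
          (∀ i → U i → Σ ℕ λ j → i < j × U j × T i j) → ∀ i₀ → U i₀ →
          Σ (ℕ → ℕ) λ g → (∀ k → g k < g (suc k)) × (∀ k → U (g k)) ×
                          (∀ k → T (g k) (g (suc k)))
iterate U T next i₀ u₀ = proj₁ ∘ walk , (λ k → proj₁ (jump k)) ,
                         (λ k → proj₂ (walk k)) , (λ k → proj₂ (jump k))
  where
  walk : ℕ → Σ ℕ U
  walk zero    = i₀ , u₀
  walk (suc k) = let (j , _ , uj , _) = next (proj₁ (walk k)) (proj₂ (walk k)) in j , uj
  jump : ∀ k → proj₁ (walk k) < proj₁ (walk (suc k)) × T (proj₁ (walk k)) (proj₁ (walk (suc k)))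
  jump k = let (_ , i<j , _ , t) = next (proj₁ (walk k)) (proj₂ (walk k)) in i<j , t

ascending-map : {X : Set} {R R' : X → X → Set} → (∀ a b → R a b → R' a b) →
                Ascending R → Ascending R'
ascending-map weaken asc f =
  let (g , mono , chain) = asc f in g , mono , λ i<j → weaken _ _ (chain i<j)

-- Ascending subsequences for two relations can be found simultaneously,
-- by extracting one inside the other.
ascending-× : {X : Set} {R₁ R₂ : X → X → Set} → Ascending R₁ → Ascending R₂ →
              Ascending (λ a b → R₁ a b × R₂ a b)
ascending-× asc₁ asc₂ f =
  let (g₁ , mono₁ , chain₁) = asc₁ f
      (g₂ , mono₂ , chain₂) = asc₂ (f ∘ g₁)
  in g₁ ∘ g₂ , (λ i<j → mono₁ (mono₂ i<j)) , λ i<j → chain₁ (mono₂ i<j) , chain₂ i<j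

ascending-Π : {X : Set} {m : ℕ} (R : Fin m → X → X → Set) →
              (∀ c → Ascending (R c)) → Ascending (λ a b → ∀ c → R c a b)
ascending-Π {m = zero}  R asc f = (λ k → k) , (λ i<j → i<j) , λ _ ()
ascending-Π {m = suc m} R asc =
  ascending-map split (ascending-× {R₁ = R fzero} {λ a b → ∀ c → R (fsuc c) a b}
                        (asc fzero) (ascending-Π (R ∘ fsuc) (asc ∘ fsuc)))
  where
  split : ∀ a b → R fzero a b × (∀ c → R (fsuc c) a b) → ∀ c → R c a b
  split _ _ (r , rs) fzero    = r
  split _ _ (r , rs) (fsuc c) = rs c

module Classical (em : ExcludedMiddle) where

  stable : {A : Set} → ¬ ¬ A → A
  stable {A} = decidable-stable (em A)

  notAll : {X : Set} (Q : X → Set) → ¬ (∀ x → Q x) → Σ X λ x → ¬ Q x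
  notAll Q ¬all = stable λ none → ¬all λ x → stable λ ¬Qx → none (x , ¬Qx)

  leastℕ : (P : ℕ → Set) → ∀ n → P n → ∃ (IsLeast _≤_ P)
  leastℕ P = <-rec (λ n → P n → ∃ (IsLeast _≤_ P)) search
    where
    search : ∀ n → (∀ {m} → m < n → P m → ∃ (IsLeast _≤_ P)) → P n →
             ∃ (IsLeast _≤_ P)
    search n below Pn with em (Σ ℕ λ m → m < n × P m)
    ... | yes (m , m<n , Pm) = below m<n Pm
    ... | no  none           = n , Pn , λ k Pk → ℕ.≮⇒≥ λ k<n → none (k , k<n , Pk)

  leastℤ : (P : ℤ → Set) (b : ℤ) → (∀ z → P z → b ≤ℤ z) →
           ∀ z → P z → ∃ (IsLeast _≤ℤ_ P)
  leastℤ P b bound z Pz =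
    let (m , Pm , least) = leastℕ (λ k → P (b +ℤ + k)) _ (shift Pz)
    in b +ℤ + m , Pm , λ w Pw →
         subst (b +ℤ + m ≤ℤ_) (offset (bound w Pw)) (ℤ.+-monoʳ-≤ b (+≤+ (least _ (shift Pw))))
    where
    shift : ∀ {w} → P w → P (b +ℤ + ∣ w - b ∣)
    shift {w} Pw = subst P (sym (offset (bound w Pw))) Pw

  -- The same in ℤ∞: a finite lower bound excludes -∞, and +∞ is least
  -- only when it is the sole element.
  least∞ : (P : ℤ∞ → Set) (b : ℤ) → (∀ w → P w → fin b ≤∞ w) →
           ∀ a → P a → ∃ (IsLeast _≤∞_ P)
  least∞ P b bound a Pa with em (Σ ℤ λ z → P (fin z))
  ... | no noFinite = +∞ , subst P (onlyTop a Pa) Pa , λ w Pw → topBelow w Pw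
    where
    onlyTop : ∀ w → P w → w ≡ +∞
    onlyTop -∞      P-∞ = ⊥-elim (fin≰-∞ (bound -∞ P-∞))
    onlyTop (fin y) Py  = ⊥-elim (noFinite (y , Py))
    onlyTop +∞      _   = refl
    topBelow : ∀ w → P w → +∞ ≤∞ w
    topBelow w Pw = subst (+∞ ≤∞_) (sym (onlyTop w Pw)) ≤+∞
  ... | yes (z , Pz) with leastℤ (P ∘ fin) b (λ y Py → fin≤fin⁻¹ (bound (fin y) Py)) z Pz
  ... | m , Pm , least = fin m , Pm , below
    where
    below : ∀ w → P w → fin m ≤∞ w
    below -∞      P-∞ = ⊥-elim (fin≰-∞ (bound -∞ P-∞))
    below (fin y) Py  = fin≤fin (least y Py)
    below +∞      _   = ≤+∞

  greatest∞ : (P : ℤ∞ → Set) (b : ℤ) → (∀ w → P w → w ≤∞ fin b) →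
              ∀ a → P a → ∃ (IsLeast _≥∞_ P)
  greatest∞ P b bound a Pa =
    let (m , Pm , least) = least∞ (P ∘ neg∞) (-ℤ b)
          (λ w Pw → neg∞-swapˡ (bound (neg∞ w) Pw)) (neg∞ a) (negate Pa)
    in neg∞ m , Pm , λ w Pw → neg∞-swapʳ (least (neg∞ w) (negate Pw))
    where
    negate : ∀ {w} → P w → P (neg∞ (neg∞ w))
    negate {w} = subst P (sym (neg∞-involutive w))

  -- An upward closed set that contains -∞ as soon as it contains every
  -- integer has a least element: if -∞ is missing, some integer is missing,
  -- and it bounds the set from below.
  leastUpClosed : (A : ℤ∞ → Set) → (∀ {w w'} → w ≤∞ w' → A w → A w') →
                  ((∀ y → A (fin y)) → A -∞) → ∀ a → A a → ∃ (IsLeast _≤∞_ A)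
  leastUpClosed A up limit a Aa with em (A -∞)
  ... | yes A-∞ = -∞ , A-∞ , λ _ _ → -∞≤
  ... | no ¬A-∞ with notAll (A ∘ fin) (¬A-∞ ∘ limit)
  ... | y , ¬Ay = least∞ A y bound a Aa
    where
    bound : ∀ w → A w → fin y ≤∞ w
    bound -∞      A-∞ = ⊥-elim (¬A-∞ A-∞)
    bound (fin z) Az with ℤ.≤-total y z
    ... | inj₁ y≤z = fin≤fin y≤z
    ... | inj₂ z≤y = ⊥-elim (¬Ay (up (fin≤fin z≤y) Az))
    bound +∞      _   = ≤+∞

  greatestDownClosed : (A : ℤ∞ → Set) → (∀ {w w'} → w ≤∞ w' → A w' → A w) →
                       ((∀ y → A (fin y)) → A +∞) → ∀ a → A a → ∃ (IsLeast _≥∞_ A)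
  greatestDownClosed A down limit a Aa with em (A +∞)
  ... | yes A+∞ = +∞ , A+∞ , λ _ _ → ≤+∞
  ... | no ¬A+∞ with notAll (A ∘ fin) (¬A+∞ ∘ limit)
  ... | y , ¬Ay = greatest∞ A y bound a Aa
    where
    bound : ∀ w → A w → w ≤∞ fin y
    bound -∞      _   = -∞≤
    bound (fin z) Az with ℤ.≤-total z y
    ... | inj₁ z≤y = fin≤fin z≤y
    ... | inj₂ y≤z = ⊥-elim (¬Ay (down (fin≤fin y≤z) Az))
    bound +∞      A+∞ = ⊥-elim (¬A+∞ A+∞)

  -- Part (1): maximal consistent hyperrectangles

  module Maximal {n : ℕ} (S : Sample n) where

    AdmissibleLo : Hyperrectangle n → Fin n → ℤ∞ → Set
    AdmissibleLo R c w = ∀ q → Neg S q → InExcept c q R →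
                         fin (q c) ≤∞ hi (R c) → ¬ (w ≤∞ fin (q c))

    AdmissibleHi : Hyperrectangle n → Fin n → ℤ∞ → Set
    AdmissibleHi R c w = ∀ q → Neg S q → InExcept c q R →
                         lo (R c) ≤∞ fin (q c) → ¬ (fin (q c) ≤∞ w)

    admissibleLo : ∀ R R' c → Consistent R' S → R ⊆R R' → AdmissibleLo R c (lo (R' c))
    admissibleLo R R' c cons' s q neg off qc≤hi lo≤qc =
      proj₂ cons' q neg (inExcept-∈ R R' off (lo≤qc , ≤∞-trans qc≤hi (proj₂ (s c))) s)

    admissibleHi : ∀ R R' c → Consistent R' S → R ⊆R R' → AdmissibleHi R c (hi (R' c))
    admissibleHi R R' c cons' s q neg off lo≤qc qc≤hi =
      proj₂ cons' q neg (inExcept-∈ R R' off (≤∞-trans (proj₁ (s c)) lo≤qc , qc≤hi) s)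

    LoTight HiTight Tight : Hyperrectangle n → Fin n → Set
    LoTight R c = ∀ R' → Consistent R' S → R ⊆R R' → lo (R c) ≤∞ lo (R' c)
    HiTight R c = ∀ R' → Consistent R' S → R ⊆R R' → hi (R' c) ≤∞ hi (R c)
    Tight R c = LoTight R c × HiTight R c

    -- Tightness survives enlarging R: an enlargement of R₂ ⊇ R also enlarges R.
    loTight-mono : ∀ R R₂ c → R ⊆R R₂ → LoTight R c → LoTight R₂ c
    loTight-mono R R₂ c s lt R' cons' s' =
      ≤∞-trans (proj₁ (s c)) (lt R' cons' (⊆R-trans R R₂ R' s s'))

    hiTight-mono : ∀ R R₂ c → R ⊆R R₂ → HiTight R c → HiTight R₂ c
    hiTight-mono R R₂ c s ht R' cons' s' =
      ≤∞-trans (ht R' cons' (⊆R-trans R R₂ R' s s')) (proj₂ (s c))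

    tight-mono : ∀ R R₂ c → R ⊆R R₂ → Tight R c → Tight R₂ c
    tight-mono R R₂ c s (lt , ht) = loTight-mono R R₂ c s lt , hiTight-mono R R₂ c s ht

    lowerLo : ∀ R c → Consistent R S →
              Σ (Hyperrectangle n) λ R₂ → Consistent R₂ S × R ⊆R R₂ × LoTight R₂ c
    lowerLo R c cons with leastUpClosed (AdmissibleLo R c)
        (λ w≤w' adm q neg off le w'≤qc → adm q neg off le (≤∞-trans w≤w' w'≤qc))
        (λ adm q neg off le _ → adm (q c) q neg off le ≤∞-refl)
        (lo (R c)) (admissibleLo R R c cons (⊆R-refl R))
    ... | v , adm , least = R₂ , (pos , negs) , R⊆R₂ , tight
      where
      v≤lo : v ≤∞ lo (R c)
      v≤lo = least (lo (R c)) (admissibleLo R R c cons (⊆R-refl R))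
      J : Interval
      J = [ v , hi (R c) ]⟨ ≤∞-trans v≤lo (lo≤hi (R c)) ⟩
      R₂ : Hyperrectangle n
      R₂ = R [ c ≔ J ]
      R⊆R₂ : R ⊆R R₂
      R⊆R₂ = ⊆-≔ (v≤lo , ≤∞-refl)
      pos : ∀ p → Pos S p → p ∈R R₂
      pos p P = ∈R-⊆ R R₂ (proj₁ cons p P) R⊆R₂
      negs : ∀ q → Neg S q → ¬ (q ∈R R₂)
      negs q neg m with ∈-≔ m
      ... | (v≤qc , qc≤hi) , off = adm q neg off qc≤hi v≤qc
      tight : LoTight R₂ c
      tight R' cons' s = subst (λ I → lo I ≤∞ lo (R' c)) (sym (≔-at R c J))
        (least (lo (R' c)) (admissibleLo R R' c cons' (⊆R-trans R R₂ R' R⊆R₂ s)))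

    raiseHi : ∀ R c → Consistent R S →
              Σ (Hyperrectangle n) λ R₂ → Consistent R₂ S × R ⊆R R₂ × HiTight R₂ c
    raiseHi R c cons with greatestDownClosed (AdmissibleHi R c)
        (λ w≤w' adm q neg off le qc≤w → adm q neg off le (≤∞-trans qc≤w w≤w'))
        (λ adm q neg off le _ → adm (q c) q neg off le ≤∞-refl)
        (hi (R c)) (admissibleHi R R c cons (⊆R-refl R))
    ... | v , adm , greatest = R₂ , (pos , negs) , R⊆R₂ , tight
      where
      hi≤v : hi (R c) ≤∞ v
      hi≤v = greatest (hi (R c)) (admissibleHi R R c cons (⊆R-refl R))
      J : Interval
      J = [ lo (R c) , v ]⟨ ≤∞-trans (lo≤hi (R c)) hi≤v ⟩
      R₂ : Hyperrectangle n
      R₂ = R [ c ≔ J ]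
      R⊆R₂ : R ⊆R R₂
      R⊆R₂ = ⊆-≔ (≤∞-refl , hi≤v)
      pos : ∀ p → Pos S p → p ∈R R₂
      pos p P = ∈R-⊆ R R₂ (proj₁ cons p P) R⊆R₂
      negs : ∀ q → Neg S q → ¬ (q ∈R R₂)
      negs q neg m with ∈-≔ m
      ... | (lo≤qc , qc≤v) , off = adm q neg off lo≤qc qc≤v
      tight : HiTight R₂ c
      tight R' cons' s = subst (λ I → hi (R' c) ≤∞ hi I) (sym (≔-at R c J))
        (greatest (hi (R' c)) (admissibleHi R R' c cons' (⊆R-trans R R₂ R' R⊆R₂ s)))

    tightenAll : (L : List (Fin n)) → ∀ R → Consistent R S →
                 Σ (Hyperrectangle n) λ R' → Consistent R' S × All (Tight R') L
    tightenAll []      R cons = R , cons , []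
    tightenAll (c ∷ L) R cons with tightenAll L R cons
    ... | R₁ , cons₁ , tights with lowerLo R₁ c cons₁
    ... | R₂ , cons₂ , s₂ , loTight with raiseHi R₂ c cons₂
    ... | R₃ , cons₃ , s₃ , hiTight =
      R₃ , cons₃ ,
      (loTight-mono R₂ R₃ c s₃ loTight , hiTight) ∷
      All.map (λ {c'} → tight-mono R₁ R₃ c' (⊆R-trans R₁ R₂ R₃ s₂ s₃)) tights

    maximal : Realizable S → ∃ λ R → MaximalConsistent R S
    maximal (R₀ , cons₀) with tightenAll (allFin n) R₀ cons₀
    ... | R , cons , tights = R , cons , λ R' cons' s c →
      let (lt , ht) = All.lookup tights (∈-allFin c) in lt R' cons' s , ht R' cons' s

  -- Part (2): the well-quasi-order

  -- The Ramsey-type argument: for a transitive relation all of whose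
  -- sequences are good, only finitely many indices of f are terminal (have
  -- no later related index); beyond them a chain can be followed forever.
  ramsey : {X : Set} {_≼_ : X → X → Set} → (∀ {a b c} → a ≼ b → b ≼ c → a ≼ c) →
           (∀ f → Good _≼_ f) → Ascending _≼_
  ramsey {X} {_≼_} trans' good f =
    let (M , successor) = eventuallySuccessor
        (g , incr , _ , related) = iterate (M ≤_) (λ i j → f i ≼ f j)
          (λ i M≤i → let (j , i<j , r) = successor i M≤i
                     in j , i<j , ℕ.≤-trans M≤i (ℕ.<⇒≤ i<j) , r)
          M ℕ.≤-refl
    in g , steps⇒chain {_≼_ = _<_} {g} ℕ.<-trans incr ,
       steps⇒chain {_≼_ = λ a b → f a ≼ f b} {g} trans' related
    where
    HasSuccessor : ℕ → Set
    HasSuccessor i = Σ ℕ λ j → i < j × f i ≼ f j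

    -- Otherwise there are terminal indices above every bound, and an
    -- increasing sequence of them makes f bad.
    eventuallySuccessor : Σ ℕ λ M → ∀ i → M ≤ i → HasSuccessor i
    eventuallySuccessor with em (Σ ℕ λ M → ∀ i → M ≤ i → HasSuccessor i)
    ... | yes e = e
    ... | no ¬e =
      let (s , s-incr , terminal , _) = iterate (¬_ ∘ HasSuccessor) (λ _ _ → ⊤)
            (λ i _ → let (j , i<j , tj) = terminalAbove (suc i) in j , i<j , tj , tt)
            _ (proj₂ (proj₂ (terminalAbove 0)))
          (i , j , i<j , r) = good (f ∘ s)
      in ⊥-elim (terminal i (s j , steps⇒chain {_≼_ = _<_} {s} ℕ.<-trans s-incr i<j , r))
      where
      terminalAbove : ∀ M → Σ ℕ λ i → M ≤ i × ¬ HasSuccessor i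
      terminalAbove M with notAll (λ i → M ≤ i → HasSuccessor i) (λ all → ¬e (M , all))
      ... | i , ¬imp = i , stable (λ M≰i → ¬imp (⊥-elim ∘ M≰i)) , λ hs → ¬imp (λ _ → hs)

  Image : (ℕ → ℤ∞) → ℤ∞ → Set
  Image x w = Σ ℕ λ k → x k ≡ w

  -- A sequence bounded above by an integer attains its maximum at some k,
  -- so x (k + 1) ≤ x k.
  boundedAbove⇒good : (x : ℕ → ℤ∞) (b : ℤ) → (∀ k → x k ≤∞ fin b) → Good _≥∞_ x
  boundedAbove⇒good x b bound
    with greatest∞ (Image x) b (λ { _ (k , refl) → bound k }) (x 0) (0 , refl)
  ... | _ , (k , refl) , greatest = k , suc k , ℕ.n<1+n k , greatest _ (suc k , refl)

  -- Dually, a sequence bounded below attains its minimum.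
  boundedBelow⇒good : (x : ℕ → ℤ∞) (b : ℤ) → (∀ k → fin b ≤∞ x k) → Good _≤∞_ x
  boundedBelow⇒good x b bound
    with least∞ (Image x) b (λ { _ (k , refl) → bound k }) (x 0) (0 , refl)
  ... | _ , (k , refl) , least = k , suc k , ℕ.n<1+n k , least _ (suc k , refl)

  -- Part (2): each coordinate relation is good by the two lemmas above, so
  -- inclusion, their intersection, has ascending subsequences.
  ℛ-wqo : ∀ {n} (p : Point n) → IsWQO (ℛ p) _⊆ℛ_
  ℛ-wqo p = record
    { refl  = λ A → ⊆R-refl (proj₁ A)
    ; trans = λ {A} {B} {C} → ⊆R-trans (proj₁ A) (proj₁ B) (proj₁ C)
    ; good  = λ f → let (g , mono , chain) = ascending f
                    in g 0 , g 1 , mono (ℕ.n<1+n 0) , chain (ℕ.n<1+n 0)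
    }
    where
    -- Inclusion at coordinate c is the conjunction of these two relations.
    LoRel HiRel : Fin _ → ℛ p → ℛ p → Set
    LoRel c A B = lo (proj₁ B c) ≤∞ lo (proj₁ A c)
    HiRel c A B = hi (proj₁ A c) ≤∞ hi (proj₁ B c)

    ascending : Ascending _⊆ℛ_
    ascending = ascending-Π (λ c A B → proj₁ A c ⊆I proj₁ B c) λ c →
      ascending-× {R₁ = LoRel c} {HiRel c}
        (ramsey {_≼_ = LoRel c} (λ ab bc → ≤∞-trans bc ab) λ f →
          boundedAbove⇒good (λ k → lo (proj₁ (f k) c)) (p c) (λ k → proj₁ (proj₂ (f k) c)))
        (ramsey {_≼_ = HiRel c} ≤∞-trans λ f →
          boundedBelow⇒good (λ k → hi (proj₁ (f k) c)) (p c) (λ k → proj₂ (proj₂ (f k) c)))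

lemma3 : ExcludedMiddle → (n : ℕ) → 1 ≤ n →
         ((S : Sample n) → Realizable S → ∃ λ R → MaximalConsistent R S)
         × ((p : Point n) → IsWQO (ℛ p) _⊆ℛ_)
lemma3 em n _ = (λ S → Maximal.maximal S) , ℛ-wqo
  where open Classical em
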